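{- Let $\psi$ be a formula and $\Sigma$ a finite multiset of formulas. If $\psi,(\psi,\Sigma)\rhd\bot\Rightarrow\Sigma$ is provable in $\mathsf{G}^{\mathrm{fin}}+\mathrm{Cut}$, then $\psi,\Sigma\rhd\bot\Rightarrow\Sigma$ is provable in $\mathsf{G}^{\mathrm{fin}}+\mathrm{Cut}$.
   Context: Formulas: $\phi ::= p \mid \bot \mid \phi\to\phi \mid \phi\rhd\phi$. A sequent $\Gamma\Rightarrow\Delta$ is a pair of finite multisets of formulas; commas denote multiset union; $\Sigma\rhd\bot := \{\sigma\rhd\bot:\sigma\in\Sigma\}$ and $(\psi,\Sigma)\rhd\bot := \{\psi\rhd\bot\}\cup(\Sigma\rhd\bot)$; for formulas $\phi_0,\dots,\phi_{m-1}$, $\Phi_{[0,i)} := \{\phi_0,\dots,\phi_{i-1}\}$. Rules: (ax) $p,\Gamma\Rightarrow p,\Delta$ for a variable $p$; ($\bot$L) $\bot,\Gamma\Rightarrow\Delta$; ($\bot$R) from $\Gamma\Rightarrow\Delta$ infer $\Gamma\Rightarrow\bot,\Delta$; ($\to$L) from $\Gamma\Rightarrow\Delta,\phi$ and $\psi,\Gamma\Rightarrow\Delta$ infer $\phi\to\psi,\Gamma\Rightarrow\Delta$; ($\to$R) from $\phi,\Gamma\Rightarrow\Delta,\psi$ infer $\Gamma\Rightarrow\Delta,\phi\to\psi$; ($\rhd_{\mathsf{IL}}$) for $m\ge0$: from the premises $\psi_i,(\psi_i,\Phi_{[0,i)},\phi)\rhd\bot\Rightarrow\Phi_{[0,i)},\phi$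 ($i=0,\dots,m$) infer $\phi_0\rhd\psi_0,\dots,\phi_{m-1}\rhd\psi_{m-1},\Gamma\Rightarrow\psi_m\rhd\phi,\Delta$; (Cut) from $\Gamma\Rightarrow\Delta,\chi$ and $\chi,\Gamma\Rightarrow\Delta$ infer $\Gamma\Rightarrow\Delta$. $\mathsf{G}^{\mathrm{fin}}+\mathrm{Cut}$: ordinary finite proof trees using ax, $\bot$L, $\bot$R, $\to$L, $\to$R, $\rhd_{\mathsf{IL}}$, Cut. -}

module Defs where

open import Data.Nat using (ℕ)
open import Data.Fin using (Fin; toℕ)
open import Data.List using (List; []; _∷_; _++_; map; take)
open import Data.Vec using (Vec; toList; lookup; _∷ʳ_; zipWith)
open import Data.List.Relation.Binary.Permutation.Propositional using (_↭_)

data Fm : Set where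
  var  : ℕ → Fm
  bot  : Fm
  _⇒_  : Fm → Fm → Fm
  _▷_  : Fm → Fm → Fm

infixr 5 _⇒_
infix  6 _▷_

_▷⊥ : List Fm → List Fm
Σ ▷⊥ = map (λ σ → σ ▷ bot) Σ

-- Finite multisets are represented by lists; the rule `perm` below closes
-- derivability under reordering of either side, so provability is a
-- property of the underlying multisets.
data _⊢_ : List Fm → List Fm → Set where
  perm  : ∀ {Γ Γ' Δ Δ'} → Γ ↭ Γ' → Δ ↭ Δ' → Γ ⊢ Δ → Γ' ⊢ Δ'
  ax    : ∀ {p Γ Δ} → (var p ∷ Γ) ⊢ (var p ∷ Δ)
  botL  : ∀ {Γ Δ} → (bot ∷ Γ) ⊢ Δ
  botR  : ∀ {Γ Δ} → Γ ⊢ Δ → Γ ⊢ (bot ∷ Δ)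
  impL  : ∀ {φ ψ Γ Δ} → Γ ⊢ (Δ ++ φ ∷ []) → (ψ ∷ Γ) ⊢ Δ → ((φ ⇒ ψ) ∷ Γ) ⊢ Δ
  impR  : ∀ {φ ψ Γ Δ} → (φ ∷ Γ) ⊢ (Δ ++ ψ ∷ []) → Γ ⊢ (Δ ++ (φ ⇒ ψ) ∷ [])
  -- (▷_IL), m ≥ 0: φs = φ_0..φ_{m-1}, ψs = ψ_0..ψ_{m-1}, ψm = ψ_m.
  ilR   : ∀ {m Γ Δ φ ψm} (φs ψs : Vec Fm m) →
          ((i : Fin (Data.Nat.suc m)) →
             let ψi = lookup (ψs ∷ʳ ψm) i
                 Φi = take (toℕ i) (toList φs)
             in (ψi ∷ ((ψi ∷ Φi ++ φ ∷ []) ▷⊥)) ⊢ (Φi ++ φ ∷ [])) →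
          (toList (zipWith _▷_ φs ψs) ++ Γ) ⊢ ((ψm ▷ φ) ∷ Δ)
  cut   : ∀ {χ Γ Δ} → Γ ⊢ (Δ ++ χ ∷ []) → (χ ∷ Γ) ⊢ Δ → Γ ⊢ Δ

{-# OPTIONS --safe #-}
module Submission where

-- Apply (▷_IL) with φ = ⊥, φ_i = σ_i, ψ_i = ⊥ (so the antecedents are Σ ▷ ⊥)
-- and ψ_m = ψ.  Every premise but the last has ⊥ on the left, so is an
-- instance of (⊥L); the last one is the hypothesis weakened by ⊥ ▷ ⊥ and ⊥.
-- This derives ψ, Σ ▷ ⊥ ⇒ Σ, ψ ▷ ⊥, and a cut on ψ ▷ ⊥ against the
-- hypothesis finishes.

open import Defs
open import Data.List using (List; []; _∷_; _++_; _∷ʳ_; map; take; length)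
open import Data.List.Properties using (map-++; take-all)
open import Data.Nat using (zero; suc)
open import Data.Nat.Properties using (≤-refl)
open import Data.Fin using (Fin; toℕ; zero; suc)
open import Data.Vec using (toList; fromList; lookup; replicate; zipWith)
  renaming (_∷ʳ_ to _∷ʳᵛ_)
open import Data.Vec.Properties using (zipWith-replicate₂; toList-map; toList∘fromList)
open import Data.Sum using (_⊎_; inj₁; inj₂)
open import Data.Product using (_×_; _,_)
open import Relation.Binary.PropositionalEquality using (_≡_; refl; cong; subst; module ≡-Reasoning)
open ≡-Reasoning
open import Data.List.Relation.Binary.Permutation.Propositional
  using (prep; swap; ↭-refl; ↭-sym)
open import Data.List.Relation.Binary.Permutation.Propositional.Properties
  using (shift; ∷↭∷ʳ)

exchangeˡ : ∀ {A B Γ Δ} → (A ∷ B ∷ Γ) ⊢ Δ → (B ∷ A ∷ Γ) ⊢ Δ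
exchangeˡ = perm (swap _ _ ↭-refl) ↭-refl

weakenˡ : ∀ {Γ Δ} A → Γ ⊢ Δ → (A ∷ Γ) ⊢ Δ
weakenˡ A (perm p q d) = perm (prep A p) q (weakenˡ A d)
weakenˡ A ax           = exchangeˡ ax
weakenˡ A botL         = exchangeˡ botL
weakenˡ A (botR d)     = botR (weakenˡ A d)
weakenˡ A (impL d e)   = exchangeˡ (impL (weakenˡ A d) (exchangeˡ (weakenˡ A e)))
weakenˡ A (impR d)     = impR (exchangeˡ (weakenˡ A d))
weakenˡ A (cut d e)    = cut (weakenˡ A d) (exchangeˡ (weakenˡ A e))
weakenˡ A (ilR {Γ = Γ} φs ψs prems) =
  perm (shift A (toList (zipWith _▷_ φs ψs)) Γ) ↭-refl (ilR {Γ = A ∷ Γ} φs ψs prems)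

weakenˡ-∷ʳ : ∀ {Γ Δ} A → Γ ⊢ Δ → (Γ ∷ʳ A) ⊢ Δ
weakenˡ-∷ʳ {Γ} A d = perm (∷↭∷ʳ A Γ) ↭-refl (weakenˡ A d)

botR-∷ʳ : ∀ {Γ Δ} → Γ ⊢ Δ → Γ ⊢ (Δ ∷ʳ bot)
botR-∷ʳ {Δ = Δ} d = perm ↭-refl (∷↭∷ʳ bot Δ) (botR d)

▷⊥-∷ʳ : ∀ Σ σ → (Σ ∷ʳ σ) ▷⊥ ≡ (Σ ▷⊥) ∷ʳ (σ ▷ bot)
▷⊥-∷ʳ Σ σ = map-++ (λ τ → τ ▷ bot) Σ (σ ∷ [])

zipWith-▷-replicate-bot : ∀ Σ → toList (zipWith _▷_ (fromList Σ) (replicate (length Σ) bot)) ≡ Σ ▷⊥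
zipWith-▷-replicate-bot Σ = begin
  toList (zipWith _▷_ (fromList Σ) (replicate (length Σ) bot))
    ≡⟨ cong toList (zipWith-replicate₂ _▷_ (fromList Σ) bot) ⟩
  toList (Data.Vec.map (λ τ → τ ▷ bot) (fromList Σ))
    ≡⟨ toList-map (λ τ → τ ▷ bot) (fromList Σ) ⟩
  map (λ τ → τ ▷ bot) (toList (fromList Σ))
    ≡⟨ cong (map (λ τ → τ ▷ bot)) (toList∘fromList Σ) ⟩
  Σ ▷⊥ ∎

lookup-replicate-∷ʳ : ∀ {A : Set} (x y : A) n (i : Fin (suc n)) →
  lookup (replicate n x ∷ʳᵛ y) i ≡ x ⊎ (lookup (replicate n x ∷ʳᵛ y) i ≡ y × toℕ i ≡ n)
lookup-replicate-∷ʳ x y zero    zero    = inj₂ (refl , refl)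
lookup-replicate-∷ʳ x y (suc n) zero    = inj₁ refl
lookup-replicate-∷ʳ x y (suc n) (suc i) with lookup-replicate-∷ʳ x y n i
... | inj₁ eq         = inj₁ eq
... | inj₂ (eq , i≡n) = inj₂ (eq , cong suc i≡n)

▷⊥-introduction : ∀ {Γ Δ} ψ φ Σ →
  (ψ ∷ ((ψ ∷ Σ ∷ʳ φ) ▷⊥)) ⊢ (Σ ∷ʳ φ) →
  ((Σ ▷⊥) ++ Γ) ⊢ ((ψ ▷ φ) ∷ Δ)
▷⊥-introduction {Γ} {Δ} ψ φ Σ lastPremise =
  subst (λ L → (L ++ Γ) ⊢ ((ψ ▷ φ) ∷ Δ)) (zipWith-▷-replicate-bot Σ)
    (ilR (fromList Σ) (replicate (length Σ) bot) premise)
  where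
  premise : (i : Fin (suc (length Σ))) →
    let ψi = lookup (replicate (length Σ) bot ∷ʳᵛ ψ) i
        Φi = take (toℕ i) (toList (fromList Σ))
    in (ψi ∷ ((ψi ∷ Φi ++ φ ∷ []) ▷⊥)) ⊢ (Φi ++ φ ∷ [])
  premise i with lookup-replicate-∷ʳ bot ψ (length Σ) i
  ... | inj₁ ψi≡⊥ rewrite ψi≡⊥ = botL
  ... | inj₂ (ψi≡ψ , i≡n)
    rewrite ψi≡ψ | i≡n | toList∘fromList Σ | take-all (length Σ) Σ ≤-refl = lastPremise

mainTheorem17 : (ψ : Fm) (Σ : List Fm) →
    (ψ ∷ ((ψ ∷ Σ) ▷⊥)) ⊢ Σ →
    (ψ ∷ (Σ ▷⊥)) ⊢ Σ
mainTheorem17 ψ Σ H = cut derives-ψ▷⊥ (exchangeˡ H)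
  where
  lastPremise : (ψ ∷ ((ψ ∷ Σ ∷ʳ bot) ▷⊥)) ⊢ (Σ ∷ʳ bot)
  lastPremise rewrite ▷⊥-∷ʳ Σ bot = botR-∷ʳ (weakenˡ-∷ʳ (bot ▷ bot) H)
  derives-ψ▷⊥ : (ψ ∷ (Σ ▷⊥)) ⊢ (Σ ∷ʳ (ψ ▷ bot))
  derives-ψ▷⊥ = perm (↭-sym (∷↭∷ʳ ψ (Σ ▷⊥))) (∷↭∷ʳ (ψ ▷ bot) Σ)
             (▷⊥-introduction {Γ = ψ ∷ []} ψ bot Σ lastPremise)
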